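{- If $\mathbb V\in\{\mathbb G,\mathbb V(\mathbf{3_{dblst}},\mathbf{4_{dmba}}),\mathbb V(\mathbf{3_{klst}},\mathbf{4_{dmba}}),\mathbb{AG}\}$, then $\mathbf 2\notin\mathrm{Amal}(\mathbb V)$.
   Context: All algebras have signature $\langle \lor,\land,{}^*,{}',0,1\rangle$. An Almost Gautama algebra is an algebra $\mathbf A$ such that: (a) $\langle A,\lor,\land,{}^*,0,1\rangle$ is a Stone algebra (bounded distributive lattice with pseudocomplement ${}^*$ and $x^*\lor x^{**}\approx 1$); (b) $\langle A,\lor,\land,{}',0,1\rangle$ is a bounded distributive lattice with $0'\approx1$, $1'\approx0$, $(x\land y)'\approx x'\lor y'$, $(x\lor y)''\approx x''\lor y''$, $x''\le x$; (c) $x\land x'{}^*{}'\le y\lor y^*$; (d) $x^*{}''\approx x^*$; (e) $(x\land x'^*)'^*\approx x\land x'^*$. $\mathbb{AG}$ is the variety of Almost Gautama algebras; $\mathbb V(\mathbf K)$ is the variety generated by $\mathbf K$. $\mathbf 2$ is the two-element Boolean algebra with ${}^*$ and ${}'$ both the complement. On the chain $0<c<1$: $\mathbf{3_{dblst}}$ has $0^*=1,c^*=0,1^*=0$, $0'=1,c'=1,1'=0$; $\mathbf{3_{klst}}$ has the same ${}^*$ and $0'=1,c'=c,1'=0$. $\mathbf{4_{dmba}}$ is the Boolean lattice $\{0,a,b,1\}$ with ${}^*$ the Boolean complement and $0'=1,1'=0,a'=a,b'=b$. $\mathbb G$ is the variety of Gautama algebras, the subvariety of $\mathbb{AG}$ defined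 by $x^*{}'\approx x^{**}$, equal to $\mathbb V(\mathbf{3_{dblst}},\mathbf{3_{klst}})$. An algebra $\mathbf A\in\mathbb K$ is an amalgamation base in $\mathbb K$ if for all $\mathbf B,\mathbf C\in\mathbb K$ and embeddings $f:\mathbf A\to\mathbf B$, $g:\mathbf A\to\mathbf C$ there exist $\mathbf D\in\mathbb K$ and embeddings $f_1:\mathbf B\to\mathbf D$, $g_1:\mathbf C\to\mathbf D$ with $f_1f=g_1g$; $\mathrm{Amal}(\mathbb K)$ is the class of amalgamation bases in $\mathbb K$. -}

module Defs where

open import Data.Nat using (ℕ)
open import Data.Bool using (Bool; true; false; not; _∨_; _∧_)
open import Data.Product using (Σ; _×_; _,_)
open import Data.Sum using (_⊎_)
open import Relation.Binary.PropositionalEquality using (_≡_)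
open import Function.Definitions using (Injective)

record Alg : Set₁ where
  field
    Carrier : Set
    _⊔_ _⊓_ : Carrier → Carrier → Carrier
    _* _′   : Carrier → Carrier
    𝟎 𝟏     : Carrier


Class : Set₂
Class = Alg → Set₁

record Emb (A B : Alg) : Set where
  private
    module A = Alg A
    module B = Alg B
  field
    map     : A.Carrier → B.Carrier
    inj     : Injective _≡_ _≡_ map
    pres-⊔  : ∀ x y → map (x A.⊔ y) ≡ (map x B.⊔ map y)
    pres-⊓  : ∀ x y → map (x A.⊓ y) ≡ (map x B.⊓ map y)
    pres-*  : ∀ x → map (x A.*) ≡ (map x B.*)
    pres-′  : ∀ x → map (x A.′) ≡ (map x B.′)
    pres-𝟎  : map A.𝟎 ≡ B.𝟎
    pres-𝟏  : map A.𝟏 ≡ B.𝟏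

open Emb public

AmalBase : Class → Alg → Set₁
AmalBase K A =
  K A ×
  (∀ (B C : Alg) → K B → K C → (f : Emb A B) (g : Emb A C) →
    Σ Alg λ D → K D × Σ (Emb B D) λ f₁ → Σ (Emb C D) λ g₁ →
      ∀ x → map f₁ (map f x) ≡ map g₁ (map g x))

data Term : Set where
  var      : ℕ → Term
  _∨ₜ_ _∧ₜ_ : Term → Term → Term
  _*ₜ _′ₜ  : Term → Term
  0ₜ 1ₜ    : Term

⟦_⟧ : Term → (A : Alg) → (ℕ → Alg.Carrier A) → Alg.Carrier A
⟦ var i ⟧ A ρ = ρ i
⟦ s ∨ₜ t ⟧ A ρ = Alg._⊔_ A (⟦ s ⟧ A ρ) (⟦ t ⟧ A ρ)
⟦ s ∧ₜ t ⟧ A ρ = Alg._⊓_ A (⟦ s ⟧ A ρ) (⟦ t ⟧ A ρ)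
⟦ s *ₜ ⟧ A ρ = Alg._* A (⟦ s ⟧ A ρ)
⟦ s ′ₜ ⟧ A ρ = Alg._′ A (⟦ s ⟧ A ρ)
⟦ 0ₜ ⟧ A ρ = Alg.𝟎 A
⟦ 1ₜ ⟧ A ρ = Alg.𝟏 A

_⊨_≈_ : Alg → Term → Term → Set
A ⊨ s ≈ t = ∀ (ρ : ℕ → Alg.Carrier A) → ⟦ s ⟧ A ρ ≡ ⟦ t ⟧ A ρ

-- 𝕍 K: the variety generated by K, i.e. the class of all algebras
-- satisfying every identity that holds in every member of K.
𝕍 : Class → Class
𝕍 K D = ∀ s t → (∀ A → K A → A ⊨ s ≈ t) → D ⊨ s ≈ t

Pair : Alg → Alg → Class
Pair A B X = (X ≡ A) ⊎ (X ≡ B)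

record IsAG (A : Alg) : Set₁ where
  open Alg A
  _≤_ : Carrier → Carrier → Set
  x ≤ y = (x ⊓ y) ≡ x
  field
    ⊔-assoc : ∀ x y z → ((x ⊔ y) ⊔ z) ≡ (x ⊔ (y ⊔ z))
    ⊓-assoc : ∀ x y z → ((x ⊓ y) ⊓ z) ≡ (x ⊓ (y ⊓ z))
    ⊔-comm  : ∀ x y → (x ⊔ y) ≡ (y ⊔ x)
    ⊓-comm  : ∀ x y → (x ⊓ y) ≡ (y ⊓ x)
    ⊔-absorbs-⊓ : ∀ x y → (x ⊔ (x ⊓ y)) ≡ x
    ⊓-absorbs-⊔ : ∀ x y → (x ⊓ (x ⊔ y)) ≡ x
    distrib : ∀ x y z → (x ⊓ (y ⊔ z)) ≡ ((x ⊓ y) ⊔ (x ⊓ z))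
    ⊔-identity : ∀ x → (x ⊔ 𝟎) ≡ x
    ⊓-identity : ∀ x → (x ⊓ 𝟏) ≡ x
    pc-meet : ∀ x → (x ⊓ (x *)) ≡ 𝟎
    pc-max  : ∀ x y → (x ⊓ y) ≡ 𝟎 → y ≤ (x *)
    stone   : ∀ x → ((x *) ⊔ ((x *) *)) ≡ 𝟏
    0′ : (𝟎 ′) ≡ 𝟏
    1′ : (𝟏 ′) ≡ 𝟎
    ⊓-′ : ∀ x y → ((x ⊓ y) ′) ≡ ((x ′) ⊔ (y ′))
    ⊔-′′ : ∀ x y → (((x ⊔ y) ′) ′) ≡ (((x ′) ′) ⊔ ((y ′) ′))
    ′′-≤ : ∀ x → ((x ′) ′) ≤ x
    axc : ∀ x y → (x ⊓ (((x ′) *) ′)) ≤ (y ⊔ (y *))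
    axd : ∀ x → (((x *) ′) ′) ≡ (x *)
    axe : ∀ x → (((x ⊓ ((x ′) *)) ′) *) ≡ (x ⊓ ((x ′) *))

𝔸𝔾 : Class
𝔸𝔾 = IsAG

𝔾 : Class
𝔾 A = IsAG A × (∀ x → Alg._′ A (Alg._* A x) ≡ Alg._* A (Alg._* A x))

𝟐 : Alg
𝟐 = record { Carrier = Bool ; _⊔_ = _∨_ ; _⊓_ = _∧_ ; _* = not ; _′ = not
           ; 𝟎 = false ; 𝟏 = true }

data Three : Set where
  o c i : Three

max₃ min₃ : Three → Three → Three
max₃ o y = y
max₃ c o = c
max₃ c y = y
max₃ i y = i
min₃ o y = o
min₃ c o = o
min₃ c y = c
min₃ i y = y

star₃ : Three → Three
star₃ o = i
star₃ c = o
star₃ i = o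

dbl′ : Three → Three
dbl′ o = i
dbl′ c = i
dbl′ i = o

kl′ : Three → Three
kl′ o = i
kl′ c = c
kl′ i = o

𝟑dblst : Alg
𝟑dblst = record { Carrier = Three ; _⊔_ = max₃ ; _⊓_ = min₃ ; _* = star₃
                ; _′ = dbl′ ; 𝟎 = o ; 𝟏 = i }

𝟑klst : Alg
𝟑klst = record { Carrier = Three ; _⊔_ = max₃ ; _⊓_ = min₃ ; _* = star₃
               ; _′ = kl′ ; 𝟎 = o ; 𝟏 = i }

data Four : Set where
  ⊥₄ a b ⊤₄ : Four

join₄ meet₄ : Four → Four → Four
join₄ ⊥₄ y = y
join₄ ⊤₄ y = ⊤₄
join₄ a ⊥₄ = a
join₄ a a = a
join₄ a b = ⊤₄
join₄ a ⊤₄ = ⊤₄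
join₄ b ⊥₄ = b
join₄ b a = ⊤₄
join₄ b b = b
join₄ b ⊤₄ = ⊤₄
meet₄ ⊥₄ y = ⊥₄
meet₄ ⊤₄ y = y
meet₄ a ⊥₄ = ⊥₄
meet₄ a a = a
meet₄ a b = ⊥₄
meet₄ a ⊤₄ = a
meet₄ b ⊥₄ = ⊥₄
meet₄ b a = ⊥₄
meet₄ b b = b
meet₄ b ⊤₄ = b

compl₄ : Four → Four
compl₄ ⊥₄ = ⊤₄
compl₄ a = b
compl₄ b = a
compl₄ ⊤₄ = ⊥₄

dm₄ : Four → Four
dm₄ ⊥₄ = ⊤₄
dm₄ a = a
dm₄ b = b
dm₄ ⊤₄ = ⊥₄

𝟒dmba : Alg
𝟒dmba = record { Carrier = Four ; _⊔_ = join₄ ; _⊓_ = meet₄ ; _* = compl₄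
               ; _′ = dm₄ ; 𝟎 = ⊥₄ ; 𝟏 = ⊤₄ }

-- In each case two algebras B and C of the class, both containing 𝟐, have no
-- common extension in the class at all, so the V-formation B ← 𝟐 → C cannot
-- be amalgamated.  For 𝔾 and 𝔸𝔾 take B = 𝟑dblst and C = 𝟑klst: axiom (c),
-- applied in both directions, forces the two copies of the middle element c to
-- coincide, although c′ = 1 in 𝟑dblst and c′ = c in 𝟑klst.  For the two
-- varieties with 𝟒dmba, the identity δ(x) ∧ (y ∨ y*) ≈ δ(x), where
-- δ(x) = (x ∧ x′) ∨ (x* ∧ x*′), holds in the generators, hence in any
-- amalgam D; but δ(a) = 1 in 𝟒dmba while c ∨ c* = c < 1 in the chain, which
-- would force the image of c in D to be 1.
module Submission where

open import Defs
open import Data.Bool using (Bool; true; false)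
open import Data.Empty using (⊥; ⊥-elim)
open import Data.Nat using (ℕ; zero; suc)
open import Data.Product using (_×_; _,_; proj₁)
open import Data.Sum using (inj₁; inj₂)
open import Function using (_∘_; const)
open import Relation.Binary.Definitions using (DecidableEquality)
open import Relation.Binary.PropositionalEquality
open import Relation.Nullary using (¬_; Dec; yes; no)
open import Relation.Nullary.Decidable using (map′; from-yes; _×-dec_; _→-dec_)
open import Relation.Unary using (Decidable)

x₀ x₁ : Term
x₀ = var 0
x₁ = var 1

⟨_,_⟩ : {X : Set} → X → X → ℕ → X
⟨ x , y ⟩ zero    = x
⟨ x , y ⟩ (suc _) = y

axc-lhs axc-rhs δ : Term → Term
axc-lhs t = t ∧ₜ (((t ′ₜ) *ₜ) ′ₜ)
axc-rhs t = t ∨ₜ (t *ₜ)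
δ t = (t ∧ₜ (t ′ₜ)) ∨ₜ ((t *ₜ) ∧ₜ ((t *ₜ) ′ₜ))

map-⟦⟧ : ∀ {A B} (h : Emb A B) (t : Term) (ρ : ℕ → Alg.Carrier A) →
         map h (⟦ t ⟧ A ρ) ≡ ⟦ t ⟧ B (map h ∘ ρ)
map-⟦⟧ h (var n) ρ = refl
map-⟦⟧ {B = B} h (s ∨ₜ t) ρ =
  trans (pres-⊔ h _ _) (cong₂ (Alg._⊔_ B) (map-⟦⟧ h s ρ) (map-⟦⟧ h t ρ))
map-⟦⟧ {B = B} h (s ∧ₜ t) ρ =
  trans (pres-⊓ h _ _) (cong₂ (Alg._⊓_ B) (map-⟦⟧ h s ρ) (map-⟦⟧ h t ρ))
map-⟦⟧ {B = B} h (t *ₜ) ρ = trans (pres-* h _) (cong (Alg._* B) (map-⟦⟧ h t ρ))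
map-⟦⟧ {B = B} h (t ′ₜ) ρ = trans (pres-′ h _) (cong (Alg._′ B) (map-⟦⟧ h t ρ))
map-⟦⟧ h 0ₜ ρ = pres-𝟎 h
map-⟦⟧ h 1ₜ ρ = pres-𝟏 h

map-⟦⟧≡ : ∀ {A B} (h : Emb A B) (t : Term) (ρ : ℕ → Alg.Carrier A) {y : Alg.Carrier A} →
          ⟦ t ⟧ A ρ ≡ y → ⟦ t ⟧ B (map h ∘ ρ) ≡ map h y
map-⟦⟧≡ h t ρ eq = trans (sym (map-⟦⟧ h t ρ)) (cong (map h) eq)

𝕍-base : ∀ {K A} → K A → 𝕍 K A
𝕍-base KA s t holds = holds _ KA

𝕍-Pair-⊨ : ∀ {A B D} (s t : Term) → 𝕍 (Pair A B) D → A ⊨ s ≈ t → B ⊨ s ≈ t → D ⊨ s ≈ t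
𝕍-Pair-⊨ s t VD A⊨ B⊨ = VD s t λ { _ (inj₁ refl) → A⊨ ; _ (inj₂ refl) → B⊨ }

module AG {A : Alg} (ag : IsAG A) where
  open Alg A
  open IsAG ag
  open ≡-Reasoning

  ⊓-identityˡ : ∀ x → (𝟏 ⊓ x) ≡ x
  ⊓-identityˡ x = trans (⊓-comm 𝟏 x) (⊓-identity x)

  ⊔-identityˡ : ∀ x → (𝟎 ⊔ x) ≡ x
  ⊔-identityˡ x = trans (⊔-comm 𝟎 x) (⊔-identity x)

  ⊔-zeroˡ : ∀ x → (𝟏 ⊔ x) ≡ 𝟏
  ⊔-zeroˡ x = trans (cong (𝟏 ⊔_) (sym (⊓-identityˡ x))) (⊔-absorbs-⊓ 𝟏 x)

  ⊓-zeroˡ : ∀ x → (𝟎 ⊓ x) ≡ 𝟎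
  ⊓-zeroˡ x = trans (cong (𝟎 ⊓_) (sym (⊔-identityˡ x))) (⊓-absorbs-⊔ 𝟎 x)

  𝟎*≡𝟏 : (𝟎 *) ≡ 𝟏
  𝟎*≡𝟏 = trans (sym (⊓-identityˡ (𝟎 *))) (pc-max 𝟎 𝟏 (⊓-identity 𝟎))

  𝟏*≡𝟎 : (𝟏 *) ≡ 𝟎
  𝟏*≡𝟎 = trans (sym (⊓-identityˡ (𝟏 *))) (pc-meet 𝟏)

  ≤-antisym : ∀ {x y} → x ≤ y → y ≤ x → x ≡ y
  ≤-antisym {x} {y} x≤y y≤x = trans (sym x≤y) (trans (⊓-comm x y) y≤x)

  axc-≤ : ∀ {u v} → (u ⊓ (((u ′) *) ′)) ≡ u → (v ⊔ (v *)) ≡ v → u ≤ v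
  axc-≤ {u} {v} u-fixed v-fixed = begin
    u ⊓ v                                ≡⟨ cong₂ _⊓_ (sym u-fixed) (sym v-fixed) ⟩
    (u ⊓ (((u ′) *) ′)) ⊓ (v ⊔ (v *))    ≡⟨ axc u v ⟩
    u ⊓ (((u ′) *) ′)                    ≡⟨ u-fixed ⟩
    u                                    ∎

  𝟐↪ : 𝟎 ≢ 𝟏 → Emb 𝟐 A
  𝟐↪ 𝟎≢𝟏 = record
    { map = embed ; inj = embed-injective
    ; pres-⊔ = pres-⊔′ ; pres-⊓ = pres-⊓′ ; pres-* = pres-*′ ; pres-′ = pres-′′
    ; pres-𝟎 = refl ; pres-𝟏 = refl }
    where
      embed : Bool → Carrier
      embed false = 𝟎
      embed true  = 𝟏

      embed-injective : ∀ {x y} → embed x ≡ embed y → x ≡ y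
      embed-injective {false} {false} _ = refl
      embed-injective {false} {true}  e = ⊥-elim (𝟎≢𝟏 e)
      embed-injective {true}  {false} e = ⊥-elim (𝟎≢𝟏 (sym e))
      embed-injective {true}  {true}  _ = refl

      pres-⊔′ : ∀ x y → embed (Alg._⊔_ 𝟐 x y) ≡ (embed x ⊔ embed y)
      pres-⊔′ false y = sym (⊔-identityˡ (embed y))
      pres-⊔′ true  y = sym (⊔-zeroˡ (embed y))

      pres-⊓′ : ∀ x y → embed (Alg._⊓_ 𝟐 x y) ≡ (embed x ⊓ embed y)
      pres-⊓′ false y = sym (⊓-zeroˡ (embed y))
      pres-⊓′ true  y = sym (⊓-identityˡ (embed y))

      pres-*′ : ∀ x → embed (Alg._* 𝟐 x) ≡ (embed x *)
      pres-*′ false = sym 𝟎*≡𝟏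
      pres-*′ true  = sym 𝟏*≡𝟎

      pres-′′ : ∀ x → embed (Alg._′ 𝟐 x) ≡ (embed x ′)
      pres-′′ false = sym 0′
      pres-′′ true  = sym 1′

no-common-extension⇒¬AmalBase-𝟐 : ∀ {K B C} → K B → K C → Emb 𝟐 B → Emb 𝟐 C →
  (∀ {D} → K D → Emb B D → Emb C D → ⊥) → ¬ AmalBase K 𝟐
no-common-extension⇒¬AmalBase-𝟐 KB KC ι κ no-common-extension (_ , amalgamate) =
  let D , KD , f , g , _ = amalgamate _ _ KB KC ι κ in no-common-extension KD f g

no-common-AG-extension : ∀ {D} → IsAG D → Emb 𝟑dblst D → Emb 𝟑klst D → ⊥
no-common-AG-extension {D} ag f g = c≢i (inj g (trans k≡𝟏 (sym (pres-𝟏 g))))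
  where
    open Alg D
    open AG ag
    open ≡-Reasoning

    d k : Carrier
    d = map f c
    k = map g c

    d≡k : d ≡ k
    d≡k = ≤-antisym
      (axc-≤ (map-⟦⟧≡ f (axc-lhs x₀) (const c) refl) (map-⟦⟧≡ g (axc-rhs x₀) (const c) refl))
      (axc-≤ (map-⟦⟧≡ g (axc-lhs x₀) (const c) refl) (map-⟦⟧≡ f (axc-rhs x₀) (const c) refl))

    k≡𝟏 : k ≡ 𝟏
    k≡𝟏 = begin
      k          ≡⟨ pres-′ g c ⟩
      k ′        ≡⟨ cong _′ (sym d≡k) ⟩
      d ′        ≡⟨ sym (pres-′ f c) ⟩
      map f i    ≡⟨ pres-𝟏 f ⟩
      𝟏          ∎

    c≢i : c ≢ i
    c≢i ()

δ-below-axc-rhs : Alg → Set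
δ-below-axc-rhs A = A ⊨ δ x₀ ∧ₜ axc-rhs x₁ ≈ δ x₀

no-common-δ-below-axc-rhs-extension : ∀ {B C D} → δ-below-axc-rhs D → Emb B D → Emb C D →
  (β : Alg.Carrier B) → ⟦ 1ₜ ∧ₜ axc-rhs x₀ ⟧ B (const β) ≢ Alg.𝟏 B →
  (γ : Alg.Carrier C) → ⟦ δ x₀ ⟧ C (const γ) ≡ Alg.𝟏 C → ⊥
no-common-δ-below-axc-rhs-extension {B} {C} {D} D⊨ f g β β-low γ δγ≡𝟏 =
  β-low (inj f (begin
    map f (⟦ 1ₜ ∧ₜ axc-rhs x₀ ⟧ B (const β))      ≡⟨ map-⟦⟧ f (1ₜ ∧ₜ axc-rhs x₀) (const β) ⟩
    𝟏 ⊓ σfβ                                       ≡⟨ cong (_⊓ σfβ) (sym δgγ≡𝟏) ⟩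
    ⟦ δ x₀ ∧ₜ axc-rhs x₁ ⟧ D ⟨ map g γ , map f β ⟩  ≡⟨ D⊨ ⟨ map g γ , map f β ⟩ ⟩
    ⟦ δ x₀ ⟧ D (const (map g γ))                  ≡⟨ δgγ≡𝟏 ⟩
    𝟏                                             ≡⟨ sym (pres-𝟏 f) ⟩
    map f (Alg.𝟏 B)                               ∎))
  where
    open Alg D
    open ≡-Reasoning

    σfβ : Carrier
    σfβ = ⟦ axc-rhs x₀ ⟧ D (const (map f β))

    δgγ≡𝟏 : ⟦ δ x₀ ⟧ D (const (map g γ)) ≡ 𝟏
    δgγ≡𝟏 = trans (map-⟦⟧≡ g (δ x₀) (const γ) δγ≡𝟏) (pres-𝟏 g)

¬AmalBase-𝕍-Pair : ∀ {B C} → Emb 𝟐 B → Emb 𝟐 C → δ-below-axc-rhs B → δ-below-axc-rhs C →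
  (β : Alg.Carrier B) → ⟦ 1ₜ ∧ₜ axc-rhs x₀ ⟧ B (const β) ≢ Alg.𝟏 B →
  (γ : Alg.Carrier C) → ⟦ δ x₀ ⟧ C (const γ) ≡ Alg.𝟏 C → ¬ AmalBase (𝕍 (Pair B C)) 𝟐
¬AmalBase-𝕍-Pair ι κ B⊨ C⊨ β β-low γ δγ≡𝟏 =
  no-common-extension⇒¬AmalBase-𝟐 (𝕍-base (inj₁ refl)) (𝕍-base (inj₂ refl)) ι κ
    λ VD f g → no-common-δ-below-axc-rhs-extension
                 (𝕍-Pair-⊨ (δ x₀ ∧ₜ axc-rhs x₁) (δ x₀) VD B⊨ C⊨) f g β β-low γ δγ≡𝟏

module Finite (A : Alg) (_≟_ : DecidableEquality (Alg.Carrier A))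
              (∀? : ∀ {P : Alg.Carrier A → Set} → Decidable P → Dec (∀ x → P x)) where
  open Alg A

  isAG? : Dec (IsAG A)
  isAG? = map′
    (λ (p₁ , p₂ , p₃ , p₄ , p₅ , p₆ , p₇ , p₈ , p₉ , p₁₀ ,
        p₁₁ , p₁₂ , p₁₃ , p₁₄ , p₁₅ , p₁₆ , p₁₇ , p₁₈ , p₁₉ , p₂₀) →
      record { ⊔-assoc = p₁ ; ⊓-assoc = p₂ ; ⊔-comm = p₃ ; ⊓-comm = p₄
             ; ⊔-absorbs-⊓ = p₅ ; ⊓-absorbs-⊔ = p₆ ; distrib = p₇
             ; ⊔-identity = p₈ ; ⊓-identity = p₉ ; pc-meet = p₁₀ ; pc-max = p₁₁
             ; stone = p₁₂ ; 0′ = p₁₃ ; 1′ = p₁₄ ; ⊓-′ = p₁₅ ; ⊔-′′ = p₁₆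
             ; ′′-≤ = p₁₇ ; axc = p₁₈ ; axd = p₁₉ ; axe = p₂₀ })
    (λ ag → let open IsAG ag in
      ⊔-assoc , ⊓-assoc , ⊔-comm , ⊓-comm , ⊔-absorbs-⊓ , ⊓-absorbs-⊔ , distrib ,
      ⊔-identity , ⊓-identity , pc-meet , pc-max , stone , 0′ , 1′ , ⊓-′ , ⊔-′′ ,
      ′′-≤ , axc , axd , axe)
    ( (∀? λ x → ∀? λ y → ∀? λ z → ((x ⊔ y) ⊔ z) ≟ (x ⊔ (y ⊔ z)))
    ×-dec (∀? λ x → ∀? λ y → ∀? λ z → ((x ⊓ y) ⊓ z) ≟ (x ⊓ (y ⊓ z)))
    ×-dec (∀? λ x → ∀? λ y → (x ⊔ y) ≟ (y ⊔ x))
    ×-dec (∀? λ x → ∀? λ y → (x ⊓ y) ≟ (y ⊓ x))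
    ×-dec (∀? λ x → ∀? λ y → (x ⊔ (x ⊓ y)) ≟ x)
    ×-dec (∀? λ x → ∀? λ y → (x ⊓ (x ⊔ y)) ≟ x)
    ×-dec (∀? λ x → ∀? λ y → ∀? λ z → (x ⊓ (y ⊔ z)) ≟ ((x ⊓ y) ⊔ (x ⊓ z)))
    ×-dec (∀? λ x → (x ⊔ 𝟎) ≟ x)
    ×-dec (∀? λ x → (x ⊓ 𝟏) ≟ x)
    ×-dec (∀? λ x → (x ⊓ (x *)) ≟ 𝟎)
    ×-dec (∀? λ x → ∀? λ y → ((x ⊓ y) ≟ 𝟎) →-dec ((y ⊓ (x *)) ≟ y))
    ×-dec (∀? λ x → ((x *) ⊔ ((x *) *)) ≟ 𝟏)
    ×-dec ((𝟎 ′) ≟ 𝟏)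
    ×-dec ((𝟏 ′) ≟ 𝟎)
    ×-dec (∀? λ x → ∀? λ y → ((x ⊓ y) ′) ≟ ((x ′) ⊔ (y ′)))
    ×-dec (∀? λ x → ∀? λ y → (((x ⊔ y) ′) ′) ≟ (((x ′) ′) ⊔ ((y ′) ′)))
    ×-dec (∀? λ x → (((x ′) ′) ⊓ x) ≟ ((x ′) ′))
    ×-dec (∀? λ x → ∀? λ y →
             ((x ⊓ (((x ′) *) ′)) ⊓ (y ⊔ (y *))) ≟ (x ⊓ (((x ′) *) ′)))
    ×-dec (∀? λ x → (((x *) ′) ′) ≟ (x *))
    ×-dec (∀? λ x → (((x ⊓ ((x ′) *)) ′) *) ≟ (x ⊓ ((x ′) *))))

  𝔾? : Dec (𝔾 A)
  𝔾? = isAG? ×-dec (∀? λ x → ((x *) ′) ≟ ((x *) *))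

  -- The law mentions only x₀ and x₁, so it suffices to check it on pairs.
  δ-below-axc-rhs? : Dec (δ-below-axc-rhs A)
  δ-below-axc-rhs? = map′ (λ holds ρ → holds (ρ 0) (ρ 1)) (λ holds x y → holds ⟨ x , y ⟩)
    (∀? λ x → ∀? λ y → ⟦ δ x₀ ∧ₜ axc-rhs x₁ ⟧ A ⟨ x , y ⟩ ≟ ⟦ δ x₀ ⟧ A ⟨ x , y ⟩)

_≟₃_ : DecidableEquality Three
o ≟₃ o = yes refl
o ≟₃ c = no λ ()
o ≟₃ i = no λ ()
c ≟₃ o = no λ ()
c ≟₃ c = yes refl
c ≟₃ i = no λ ()
i ≟₃ o = no λ ()
i ≟₃ c = no λ ()
i ≟₃ i = yes refl

∀₃? : ∀ {P : Three → Set} → Decidable P → Dec (∀ x → P x)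
∀₃? P? = map′ (λ { (p , _ , _) o → p ; (_ , p , _) c → p ; (_ , _ , p) i → p })
              (λ p → p o , p c , p i)
              (P? o ×-dec P? c ×-dec P? i)

_≟₄_ : DecidableEquality Four
⊥₄ ≟₄ ⊥₄ = yes refl
⊥₄ ≟₄ a  = no λ ()
⊥₄ ≟₄ b  = no λ ()
⊥₄ ≟₄ ⊤₄ = no λ ()
a  ≟₄ ⊥₄ = no λ ()
a  ≟₄ a  = yes refl
a  ≟₄ b  = no λ ()
a  ≟₄ ⊤₄ = no λ ()
b  ≟₄ ⊥₄ = no λ ()
b  ≟₄ a  = no λ ()
b  ≟₄ b  = yes refl
b  ≟₄ ⊤₄ = no λ ()
⊤₄ ≟₄ ⊥₄ = no λ ()
⊤₄ ≟₄ a  = no λ ()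
⊤₄ ≟₄ b  = no λ ()
⊤₄ ≟₄ ⊤₄ = yes refl

∀₄? : ∀ {P : Four → Set} → Decidable P → Dec (∀ x → P x)
∀₄? P? = map′ (λ { (p , _ , _ , _) ⊥₄ → p ; (_ , p , _ , _) a → p
                 ; (_ , _ , p , _) b → p ; (_ , _ , _ , p) ⊤₄ → p })
              (λ p → p ⊥₄ , p a , p b , p ⊤₄)
              (P? ⊥₄ ×-dec P? a ×-dec P? b ×-dec P? ⊤₄)

module 𝟑dblst? = Finite 𝟑dblst _≟₃_ ∀₃?
module 𝟑klst?  = Finite 𝟑klst _≟₃_ ∀₃?
module 𝟒dmba?  = Finite 𝟒dmba _≟₄_ ∀₄?

𝔾-𝟑dblst : 𝔾 𝟑dblst
𝔾-𝟑dblst = from-yes 𝟑dblst?.𝔾?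

𝔾-𝟑klst : 𝔾 𝟑klst
𝔾-𝟑klst = from-yes 𝟑klst?.𝔾?

isAG-𝟒dmba : IsAG 𝟒dmba
isAG-𝟒dmba = from-yes 𝟒dmba?.isAG?

𝟐↪𝟑dblst : Emb 𝟐 𝟑dblst
𝟐↪𝟑dblst = AG.𝟐↪ (proj₁ 𝔾-𝟑dblst) λ ()

𝟐↪𝟑klst : Emb 𝟐 𝟑klst
𝟐↪𝟑klst = AG.𝟐↪ (proj₁ 𝔾-𝟑klst) λ ()

𝟐↪𝟒dmba : Emb 𝟐 𝟒dmba
𝟐↪𝟒dmba = AG.𝟐↪ isAG-𝟒dmba λ ()

theorem4p9 : ¬ AmalBase 𝔾 𝟐
           × ¬ AmalBase (𝕍 (Pair 𝟑dblst 𝟒dmba)) 𝟐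
           × ¬ AmalBase (𝕍 (Pair 𝟑klst 𝟒dmba)) 𝟐
           × ¬ AmalBase 𝔸𝔾 𝟐
theorem4p9 =
    no-common-extension⇒¬AmalBase-𝟐 𝔾-𝟑dblst 𝔾-𝟑klst 𝟐↪𝟑dblst 𝟐↪𝟑klst
      (no-common-AG-extension ∘ proj₁)
  , ¬AmalBase-𝕍-Pair 𝟐↪𝟑dblst 𝟐↪𝟒dmba
      (from-yes 𝟑dblst?.δ-below-axc-rhs?) (from-yes 𝟒dmba?.δ-below-axc-rhs?) c (λ ()) a refl
  , ¬AmalBase-𝕍-Pair 𝟐↪𝟑klst 𝟐↪𝟒dmba
      (from-yes 𝟑klst?.δ-below-axc-rhs?) (from-yes 𝟒dmba?.δ-below-axc-rhs?) c (λ ()) a refl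
  , no-common-extension⇒¬AmalBase-𝟐 (proj₁ 𝔾-𝟑dblst) (proj₁ 𝔾-𝟑klst) 𝟐↪𝟑dblst 𝟐↪𝟑klst
      no-common-AG-extension
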